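{- For all closed sets $X,Y\in\mathcal C$, $X\cap Y=\mathrm{cl}(\{(\Delta;\Delta')\mid\Delta\in X,\Delta'\in Y\})$.
   Context: Formulas of BI: $\varphi,\psi ::= \top \mid \bot \mid \varphi\wedge\psi \mid \varphi\vee\psi \mid \varphi\to\psi \mid \mathsf{emp} \mid \varphi * \psi \mid \varphi \mathrel{ -\!\!*} \psi \mid a$ ($a\in\mathrm{Atom}$). Bunches: $\Delta ::= \varphi \mid \varnothing_m \mid \varnothing_a \mid \Delta , \Delta \mid \Delta ; \Delta$. A bunched context $\Delta(-)$ is a bunch with one hole; $\Delta(\Gamma)$ fills it. Bunch equivalence $\equiv$: least equivalence relation, closed under bunched contexts, making "$,$" commutative and associative with unit $\varnothing_m$ and "$;$" commutative and associative with unit $\varnothing_a$. The BI sequent calculus: (ax) $a\vdash a$; (equiv) from $\Delta'\vdash\varphi$, $\Delta\equiv\Delta'$ infer $\Delta\vdash\varphi$; (W;) from $\Delta(\Delta_1)\vdash\varphi$ infer $\Delta(\Delta_1;\Delta_2)\vdash\varphi$; (C;) from $\Delta(\Delta_1;\Delta_1)\vdash\varphi$ infer $\Delta(\Delta_1)\vdash\varphi$; (cut) from $\Delta'\vdash A$, $\Delta(A)\vdash B$ infer $\Delta(\Delta')\vdash B$; (empR) $\varnothing_m\vdash\mathsf{emp}$; (empL) from $\Delta(\varnothing_m)\vdash\varphi$ infer $\Delta(\mathsf{emp})\vdash\varphi$; (*R) from $\Delta_1\vdash\varphi$, $\Delta_2\vdash\psi$ infer $\Delta_1,\Delta_2\vdash\varphi*\psi$;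 (*L) from $\Delta(\varphi,\psi)\vdash\chi$ infer $\Delta(\varphi*\psi)\vdash\chi$; ($-\!*$R) from $\Delta,\varphi\vdash\psi$ infer $\Delta\vdash\varphi\mathrel{ -\!\!*}\psi$; ($-\!*$L) from $\Delta_1\vdash\varphi$, $\Delta(\Delta_2,\psi)\vdash\chi$ infer $\Delta((\Delta_1,\Delta_2),\varphi\mathrel{ -\!\!*}\psi)\vdash\chi$; ($\top$R) $\varnothing_a\vdash\top$; ($\top$L) from $\Delta(\varnothing_a)\vdash\varphi$ infer $\Delta(\top)\vdash\varphi$; ($\wedge$R) from $\Delta_1\vdash\varphi$, $\Delta_2\vdash\psi$ infer $\Delta_1;\Delta_2\vdash\varphi\wedge\psi$; ($\wedge$L) from $\Delta(\varphi;\psi)\vdash\chi$ infer $\Delta(\varphi\wedge\psi)\vdash\chi$; ($\to$R) from $\Delta;\varphi\vdash\psi$ infer $\Delta\vdash\varphi\to\psi$; ($\to$L) from $\Delta_1\vdash\varphi$, $\Delta(\Delta_2;\psi)\vdash\chi$ infer $\Delta((\Delta_1;\Delta_2);\varphi\to\psi)\vdash\chi$; ($\bot$L) $\Delta(\bot)\vdash\varphi$; ($\vee$R1/2) from $\Delta\vdash\varphi$ (resp. $\Delta\vdash\psi$) infer $\Delta\vdash\varphi\vee\psi$; ($\vee$L) from $\Delta(\varphi)\vdash\chi$, $\Delta(\psi)\vdash\chi$ infer $\Delta(\varphi\vee\psi)\vdash\chi$. $\Delta\vdash_{\mathsf{cf}}\varphi$ means derivable without (cut). Let $\mathrm{Bunch}$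 be the set of bunches modulo $\equiv$; $D(\varphi)=\{\Delta\in\mathrm{Bunch}\mid\Delta\vdash_{\mathsf{cf}}\varphi\}$; for $X\subseteq\mathrm{Bunch}$, $\mathrm{cl}(X)=\bigcap\{D(\varphi)\mid X\subseteq D(\varphi)\}$; $\mathcal C=\{X\subseteq\mathrm{Bunch}\mid X=\mathrm{cl}(X)\}$ is the set of closed sets. -}

module Defs where

open import Data.Nat using (ℕ)
open import Data.Product using (Σ; ∃; ∃-syntax; _×_; _,_)
open import Function.Bundles using (_⇔_)

Atom : Set
Atom = ℕ

infixr 6 _∧'_ _∨'_ _⋆_
infixr 5 _⇒_ _-⋆_

data Formula : Set where
  ⊤' ⊥' : Formula
  _∧'_ _∨'_ _⇒_ : Formula → Formula → Formula
  emp : Formula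
  _⋆_ _-⋆_ : Formula → Formula → Formula
  atom : Atom → Formula

infixl 4 _,,_ _︔_

data Bunch : Set where
  fm   : Formula → Bunch
  ∅m   : Bunch
  ∅a   : Bunch
  _,,_ : Bunch → Bunch → Bunch   -- multiplicative ","
  _︔_  : Bunch → Bunch → Bunch   -- additive ";"

data Ctx : Set where
  hole : Ctx
  _,ₗ_ : Ctx → Bunch → Ctx
  _,ᵣ_ : Bunch → Ctx → Ctx
  _︔ₗ_ : Ctx → Bunch → Ctx
  _︔ᵣ_ : Bunch → Ctx → Ctx

_[_] : Ctx → Bunch → Bunch
hole      [ Γ ] = Γ
(C ,ₗ Δ)  [ Γ ] = (C [ Γ ]) ,, Δ
(Δ ,ᵣ C)  [ Γ ] = Δ ,, (C [ Γ ])
(C ︔ₗ Δ) [ Γ ] = (C [ Γ ]) ︔ Δ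
(Δ ︔ᵣ C) [ Γ ] = Δ ︔ (C [ Γ ])

infix 3 _≡B_

data _≡B_ : Bunch → Bunch → Set where
  ≡refl  : ∀ {Δ} → Δ ≡B Δ
  ≡sym   : ∀ {Δ Δ'} → Δ ≡B Δ' → Δ' ≡B Δ
  ≡trans : ∀ {Δ₁ Δ₂ Δ₃} → Δ₁ ≡B Δ₂ → Δ₂ ≡B Δ₃ → Δ₁ ≡B Δ₃
  ≡ctx   : ∀ (C : Ctx) {Γ Γ'} → Γ ≡B Γ' → C [ Γ ] ≡B C [ Γ' ]
  ,comm  : ∀ {Δ₁ Δ₂} → (Δ₁ ,, Δ₂) ≡B (Δ₂ ,, Δ₁)
  ,assoc : ∀ {Δ₁ Δ₂ Δ₃} → ((Δ₁ ,, Δ₂) ,, Δ₃) ≡B (Δ₁ ,, (Δ₂ ,, Δ₃))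
  ,unit  : ∀ {Δ} → (Δ ,, ∅m) ≡B Δ
  ︔comm  : ∀ {Δ₁ Δ₂} → (Δ₁ ︔ Δ₂) ≡B (Δ₂ ︔ Δ₁)
  ︔assoc : ∀ {Δ₁ Δ₂ Δ₃} → ((Δ₁ ︔ Δ₂) ︔ Δ₃) ≡B (Δ₁ ︔ (Δ₂ ︔ Δ₃))
  ︔unit  : ∀ {Δ} → (Δ ︔ ∅a) ≡B Δ

infix 2 _⊢cf_

-- Cut-free BI sequent calculus (all rules except (cut)).
data _⊢cf_ : Bunch → Formula → Set where
  ax    : ∀ {a} → fm (atom a) ⊢cf atom a
  equiv : ∀ {Δ Δ' φ} → Δ' ⊢cf φ → Δ ≡B Δ' → Δ ⊢cf φ
  W︔    : ∀ (C : Ctx) {Δ₁ Δ₂ φ} → C [ Δ₁ ] ⊢cf φ → C [ Δ₁ ︔ Δ₂ ] ⊢cf φ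
  C︔    : ∀ (C : Ctx) {Δ₁ φ} → C [ Δ₁ ︔ Δ₁ ] ⊢cf φ → C [ Δ₁ ] ⊢cf φ
  empR  : ∅m ⊢cf emp
  empL  : ∀ (C : Ctx) {φ} → C [ ∅m ] ⊢cf φ → C [ fm emp ] ⊢cf φ
  ⋆R    : ∀ {Δ₁ Δ₂ φ ψ} → Δ₁ ⊢cf φ → Δ₂ ⊢cf ψ → (Δ₁ ,, Δ₂) ⊢cf φ ⋆ ψ
  ⋆L    : ∀ (C : Ctx) {φ ψ χ} → C [ fm φ ,, fm ψ ] ⊢cf χ → C [ fm (φ ⋆ ψ) ] ⊢cf χ
  -⋆R   : ∀ {Δ φ ψ} → (Δ ,, fm φ) ⊢cf ψ → Δ ⊢cf φ -⋆ ψ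
  -⋆L   : ∀ (C : Ctx) {Δ₁ Δ₂ φ ψ χ} → Δ₁ ⊢cf φ → C [ Δ₂ ,, fm ψ ] ⊢cf χ →
          C [ (Δ₁ ,, Δ₂) ,, fm (φ -⋆ ψ) ] ⊢cf χ
  ⊤R    : ∅a ⊢cf ⊤'
  ⊤L    : ∀ (C : Ctx) {φ} → C [ ∅a ] ⊢cf φ → C [ fm ⊤' ] ⊢cf φ
  ∧R    : ∀ {Δ₁ Δ₂ φ ψ} → Δ₁ ⊢cf φ → Δ₂ ⊢cf ψ → (Δ₁ ︔ Δ₂) ⊢cf φ ∧' ψ
  ∧L    : ∀ (C : Ctx) {φ ψ χ} → C [ fm φ ︔ fm ψ ] ⊢cf χ → C [ fm (φ ∧' ψ) ] ⊢cf χ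
  ⇒R    : ∀ {Δ φ ψ} → (Δ ︔ fm φ) ⊢cf ψ → Δ ⊢cf φ ⇒ ψ
  ⇒L    : ∀ (C : Ctx) {Δ₁ Δ₂ φ ψ χ} → Δ₁ ⊢cf φ → C [ Δ₂ ︔ fm ψ ] ⊢cf χ →
          C [ (Δ₁ ︔ Δ₂) ︔ fm (φ ⇒ ψ) ] ⊢cf χ
  ⊥L    : ∀ (C : Ctx) {φ} → C [ fm ⊥' ] ⊢cf φ
  ∨R₁   : ∀ {Δ φ ψ} → Δ ⊢cf φ → Δ ⊢cf φ ∨' ψ
  ∨R₂   : ∀ {Δ φ ψ} → Δ ⊢cf ψ → Δ ⊢cf φ ∨' ψ
  ∨L    : ∀ (C : Ctx) {φ ψ χ} → C [ fm φ ] ⊢cf χ → C [ fm ψ ] ⊢cf χ → C [ fm (φ ∨' ψ) ] ⊢cf χ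

-- Sets of bunches (modulo ≡) as predicates on bunches.
BSet : Set₁
BSet = Bunch → Set

_⊆_ : BSet → BSet → Set
X ⊆ Y = ∀ Γ → X Γ → Y Γ

_≐_ : BSet → BSet → Set
X ≐ Y = ∀ Γ → X Γ ⇔ Y Γ

_∩_ : BSet → BSet → BSet
(X ∩ Y) Γ = X Γ × Y Γ

D : Formula → BSet
D φ Γ = Γ ⊢cf φ

cl : BSet → BSet
cl X Γ = ∀ (φ : Formula) → X ⊆ D φ → D φ Γ

IsClosed : BSet → Set
IsClosed X = X ≐ cl X

_︔ˢ_ : BSet → BSet → BSet
(X ︔ˢ Y) Γ = ∃[ Δ ] ∃[ Δ' ] (X Δ × Y Δ' × (Γ ≡B (Δ ︔ Δ')))

module Submission where

open import Defs
open import Data.Product using (_,_)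
open import Function.Bundles using (mk⇔; Equivalence)

-- Closed sets are intersections of sets D φ, which are closed under the
-- structural rules for ";": weakening makes X ︔ˢ Y a subset of X and of Y, so
-- cl (X ︔ˢ Y) ⊆ X ∩ Y; contraction puts Γ into every D φ containing Γ ︔ Γ,
-- so X ∩ Y ⊆ cl (X ︔ˢ Y).

weakenʳ : ∀ {Δ Δ' φ} → Δ ⊢cf φ → (Δ ︔ Δ') ⊢cf φ
weakenʳ = W︔ hole

weakenˡ : ∀ {Δ Δ' φ} → Δ' ⊢cf φ → (Δ ︔ Δ') ⊢cf φ
weakenˡ d = equiv (weakenʳ d) ︔comm

contract : ∀ {Γ φ} → (Γ ︔ Γ) ⊢cf φ → Γ ⊢cf φ
contract = C︔ hole

cl-mono : ∀ {X Y} → X ⊆ Y → cl X ⊆ cl Y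
cl-mono X⊆Y Γ c φ Y⊆Dφ = c φ (λ Δ x → Y⊆Dφ Δ (X⊆Y Δ x))

closed⇒cl⊆ : ∀ {X} → IsClosed X → cl X ⊆ X
closed⇒cl⊆ closed Γ = Equivalence.from (closed Γ)

closed⇒︔ˢ⊆ˡ : ∀ {X Y} → IsClosed X → (X ︔ˢ Y) ⊆ X
closed⇒︔ˢ⊆ˡ closed Γ (Δ , Δ' , x , y , Γ≡Δ︔Δ') = closed⇒cl⊆ closed Γ λ φ X⊆Dφ →
  equiv (weakenʳ (X⊆Dφ Δ x)) Γ≡Δ︔Δ'

closed⇒︔ˢ⊆ʳ : ∀ {X Y} → IsClosed Y → (X ︔ˢ Y) ⊆ Y
closed⇒︔ˢ⊆ʳ closed Γ (Δ , Δ' , x , y , Γ≡Δ︔Δ') = closed⇒cl⊆ closed Γ λ φ Y⊆Dφ →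
  equiv (weakenˡ (Y⊆Dφ Δ' y)) Γ≡Δ︔Δ'

∩⊆cl-︔ˢ : ∀ {X Y} → (X ∩ Y) ⊆ cl (X ︔ˢ Y)
∩⊆cl-︔ˢ Γ (x , y) φ S⊆Dφ = contract (S⊆Dφ (Γ ︔ Γ) (Γ , Γ , x , y , ≡refl))

proposition6p3 : ∀ (X Y : BSet) → IsClosed X → IsClosed Y →
    (X ∩ Y) ≐ cl (X ︔ˢ Y)
proposition6p3 X Y closedX closedY Γ = mk⇔ (∩⊆cl-︔ˢ Γ) λ c →
  closed⇒cl⊆ closedX Γ (cl-mono (closed⇒︔ˢ⊆ˡ {Y = Y} closedX) Γ c) ,
  closed⇒cl⊆ closedY Γ (cl-mono (closed⇒︔ˢ⊆ʳ {X = X} closedY) Γ c)
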